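{- For every program $\alpha$ and every formula $\phi$: if $(\phi\to[\alpha]\phi)^n$ is a theorem of $\mathrm{PDL}_n$, then $\phi\to[\alpha^*]\phi$ is a theorem of $\mathrm{PDL}_n$; i.e., the rule $(\phi\to[\alpha]\phi)^n\,/\,(\phi\to[\alpha^*]\phi)$ is derivable in $\mathrm{PDL}_n$ (its conclusion is obtained from its premise by applications of the rules and axiom schemes of $\mathrm{PDL}_n$).
   Context: Let $\Pi_0$ be a nonempty set of atomic programs and $\mathsf{Prop}$ a countable set of propositional variables. Formulas and programs: $\phi::=p\mid 0\mid\neg\phi\mid\phi\to\phi\mid[\alpha]\phi$, $\alpha::=a\mid\phi?\mid\alpha;\alpha\mid\alpha\cup\alpha\mid\alpha^*$. Abbreviations: $\phi\vee\psi:=(\phi\to\psi)\to\psi$, $\phi\wedge\psi:=\neg(\neg\phi\vee\neg\psi)$, $\phi\oplus\psi:=\neg\phi\to\psi$, $\phi\odot\psi:=\neg(\neg\phi\oplus\neg\psi)$, $\phi\leftrightarrow\psi:=(\phi\to\psi)\odot(\psi\to\phi)$, $\psi^k$ the $\odot$-product of $k$ copies of $\psi$. $\mathrm{L}_n=\{i/n:0\le i\le n\}$ with $\neg x=1-x$, $x\to y=\min(1-x+y,1)$. $\mathrm{PDL}_n$ is the smallest set of formulas closed under modus ponens, uniform substitution, and necessitation (from $\phi$ infer $[\alpha]\phi$), containing: all tautologies of $n+1$-valued Łukasiewicz logic (formulas built from variables, $0,\neg,\to$ with constant value $1$ on $\mathrm{L}_n$); for every $\alpha$: $[\alpha](p\to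 q)\to([\alpha]p\to[\alpha]q)$, $[\alpha](p\oplus p)\leftrightarrow([\alpha]p\oplus[\alpha]p)$, $[\alpha](p\odot p)\leftrightarrow([\alpha]p\odot[\alpha]p)$; for all $\alpha,\beta$: $[\alpha\cup\beta]p\leftrightarrow([\alpha]p\wedge[\beta]p)$, $[\alpha;\beta]p\leftrightarrow[\alpha][\beta]p$, $[q?]p\leftrightarrow(\neg q^n\vee p)$, $[\alpha^*]p\leftrightarrow(p\wedge[\alpha][\alpha^*]p)$, $[\alpha^*]p\to[\alpha^*][\alpha^*]p$; and the induction axiom $(p\wedge[\alpha^*](p\to[\alpha]p)^n)\to[\alpha^*]p$. -}

module Defs where

open import Data.Nat using (ℕ; zero; suc; _∸_; _+_; _⊓_; _≤_)
open import Relation.Binary.PropositionalEquality using (_≡_)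

mutual
  data Fm (A : Set) : Set where
    var  : ℕ → Fm A
    bot  : Fm A
    neg  : Fm A → Fm A
    imp  : Fm A → Fm A → Fm A
    box  : Prog A → Fm A → Fm A

  data Prog (A : Set) : Set where
    atom : A → Prog A
    test : Fm A → Prog A
    seq  : Prog A → Prog A → Prog A
    cho  : Prog A → Prog A → Prog A
    star : Prog A → Prog A

module _ {A : Set} where
  _∨_ _∧_ _⊕_ _⊙_ _⇔_ : Fm A → Fm A → Fm A
  φ ∨ ψ = imp (imp φ ψ) ψ
  φ ∧ ψ = neg (neg φ ∨ neg ψ)
  φ ⊕ ψ = imp (neg φ) ψ
  φ ⊙ ψ = neg (neg φ ⊕ neg ψ)
  φ ⇔ ψ = imp φ ψ ⊙ imp ψ φ

  pow : ℕ → Fm A → Fm A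
  pow zero ψ = neg bot
  pow (suc zero) ψ = ψ
  pow (suc (suc k)) ψ = ψ ⊙ pow (suc k) ψ

  mutual
    substF : (ℕ → Fm A) → Fm A → Fm A
    substF σ (var i) = σ i
    substF σ bot = bot
    substF σ (neg φ) = neg (substF σ φ)
    substF σ (imp φ ψ) = imp (substF σ φ) (substF σ ψ)
    substF σ (box α φ) = box (substP σ α) (substF σ φ)

    substP : (ℕ → Fm A) → Prog A → Prog A
    substP σ (atom a) = atom a
    substP σ (test φ) = test (substF σ φ)
    substP σ (seq α β) = seq (substP σ α) (substP σ β)
    substP σ (cho α β) = cho (substP σ α) (substP σ β)
    substP σ (star α) = star (substP σ α)

data PForm : Set where
  pvar : ℕ → PForm
  pbot : PForm
  pneg : PForm → PForm
  pimp : PForm → PForm → PForm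

embed : {A : Set} → PForm → Fm A
embed (pvar i) = var i
embed pbot = bot
embed (pneg χ) = neg (embed χ)
embed (pimp χ θ) = imp (embed χ) (embed θ)

-- Evaluation in L_n, representing i/n by i ∈ {0,…,n}:
-- ¬x = n - x,  x → y = min(n - x + y, n).
peval : (n : ℕ) → (ℕ → ℕ) → PForm → ℕ
peval n v (pvar i) = v i
peval n v pbot = 0
peval n v (pneg χ) = n ∸ peval n v χ
peval n v (pimp χ θ) = n ⊓ ((n ∸ peval n v χ) + peval n v θ)

-- Tautology of (n+1)-valued Łukasiewicz logic: value 1 (= n/n) under every L_n-valuation
Taut : ℕ → PForm → Set
Taut n χ = (v : ℕ → ℕ) → (∀ i → v i ≤ n) → peval n v χ ≡ n

module _ {A : Set} where
  p q : Fm A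
  p = var 0
  q = var 1

data Thm {A : Set} (n : ℕ) : Fm A → Set where
  taut  : (χ : PForm) → Taut n χ → Thm n (embed χ)
  axK   : (α : Prog A) → Thm n (imp (box α (imp p q)) (imp (box α p) (box α q)))
  ax⊕   : (α : Prog A) → Thm n (box α (p ⊕ p) ⇔ (box α p ⊕ box α p))
  ax⊙   : (α : Prog A) → Thm n (box α (p ⊙ p) ⇔ (box α p ⊙ box α p))
  axCho : (α β : Prog A) → Thm n (box (cho α β) p ⇔ (box α p ∧ box β p))
  axSeq : (α β : Prog A) → Thm n (box (seq α β) p ⇔ box α (box β p))
  axTest : Thm n (box (test q) p ⇔ (neg (pow n q) ∨ p))
  axStar : (α : Prog A) → Thm n (box (star α) p ⇔ (p ∧ box α (box (star α) p)))
  ax4   : (α : Prog A) → Thm n (imp (box (star α) p) (box (star α) (box (star α) p)))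
  axInd : (α : Prog A) →
          Thm n (imp (p ∧ box (star α) (pow n (imp p (box α p)))) (box (star α) p))
  mp    : {φ ψ : Fm A} → Thm n φ → Thm n (imp φ ψ) → Thm n ψ
  us    : {φ : Fm A} → (σ : ℕ → Fm A) → Thm n φ → Thm n (substF σ φ)
  nec   : {φ : Fm A} → (α : Prog A) → Thm n φ → Thm n (box α φ)

module Submission where

-- The rule  (φ → [α]φ)ⁿ / (φ → [α*]φ)  is derived in three steps.
--   1. Necessitation with α* turns the premise into  ⊢ [α*](φ → [α]φ)ⁿ.
--   2. Uniform substitution instantiates the induction axiom at φ and α:
--        ⊢ (φ ∧ [α*](φ → [α]φ)ⁿ) → [α*]φ.
--      To substitute φ for p without touching α, α is first renamed apart
--      (every variable shifted up by one), and the renaming is undone by the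
--      same substitution that plugs in φ.
--   3. The formula  q → ((p ∧ q → r) → (p → r))  is a Łukasiewicz tautology,
--      so a theorem q can be discharged from an antecedent p ∧ q.
-- The tautology is checked semantically on L_n = {0,…,n}: the residuum
-- x ⇒ y = min(n, n - x + y) satisfies (x ⇒ y) ⇒ y = max(x, y), hence the
-- defined conjunction evaluates to min, and the required inequality follows
-- by comparing the values of p and q.

open import Defs
open import Data.Nat using (ℕ; zero; suc; _+_; _∸_; _⊓_; _⊔_; _≤_)
open import Data.Nat.Properties
open import Data.Sum using (inj₁; inj₂)
open import Relation.Binary.PropositionalEquality

module Łukasiewicz (n : ℕ) where

  -- The residuum; it is definitionally the value of an implication.
  _⇒_ : ℕ → ℕ → ℕ
  x ⇒ y = n ⊓ ((n ∸ x) + y)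

  ⇒-top : ∀ {x y} → x ≤ y → x ⇒ y ≡ n
  ⇒-top {x} {y} x≤y = m≤n⇒m⊓n≡m n≤[n∸x]+y
    where
    open ≤-Reasoning
    n≤[n∸x]+y : n ≤ (n ∸ x) + y
    n≤[n∸x]+y = begin
      n             ≤⟨ m≤n+m∸n n x ⟩
      x + (n ∸ x)   ≡⟨ +-comm x (n ∸ x) ⟩
      (n ∸ x) + x   ≤⟨ +-monoʳ-≤ (n ∸ x) x≤y ⟩
      (n ∸ x) + y   ∎

  ⇒-below : ∀ {x y} → x ≤ n → y ≤ x → x ⇒ y ≡ (n ∸ x) + y
  ⇒-below {x} {y} x≤n y≤x = m≥n⇒m⊓n≡n (begin
      (n ∸ x) + y   ≤⟨ +-monoʳ-≤ (n ∸ x) y≤x ⟩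
      (n ∸ x) + x   ≡⟨ m∸n+n≡m x≤n ⟩
      n             ∎)
    where open ≤-Reasoning

  ¬⇒-below : ∀ {x y} → x ≤ n → y ≤ x → n ∸ (x ⇒ y) ≡ x ∸ y
  ¬⇒-below {x} {y} x≤n y≤x = begin
    n ∸ (x ⇒ y)         ≡⟨ cong (n ∸_) (⇒-below x≤n y≤x) ⟩
    n ∸ ((n ∸ x) + y)   ≡⟨ ∸-+-assoc n (n ∸ x) y ⟨
    n ∸ (n ∸ x) ∸ y     ≡⟨ cong (_∸ y) (m∸[m∸n]≡n x≤n) ⟩
    x ∸ y               ∎
    where open ≡-Reasoning

  ⇒-monoʳ : ∀ x {y z} → y ≤ z → x ⇒ y ≤ x ⇒ z
  ⇒-monoʳ x y≤z = ⊓-monoʳ-≤ n (+-monoʳ-≤ (n ∸ x) y≤z)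

  ≤-⇒ : ∀ x {y} → y ≤ n → y ≤ x ⇒ y
  ≤-⇒ x {y} y≤n = ⊓-glb y≤n (m≤n+m y (n ∸ x))

  ∨-is-⊔ : ∀ {x y} → x ≤ n → y ≤ n → (x ⇒ y) ⇒ y ≡ x ⊔ y
  ∨-is-⊔ {x} {y} x≤n y≤n with ≤-total x y
  ... | inj₁ x≤y = begin
    (x ⇒ y) ⇒ y          ≡⟨ cong (_⇒ y) (⇒-top x≤y) ⟩
    n ⊓ ((n ∸ n) + y)    ≡⟨ cong (λ d → n ⊓ (d + y)) (n∸n≡0 n) ⟩
    n ⊓ y                ≡⟨ m≥n⇒m⊓n≡n y≤n ⟩
    y                    ≡⟨ m≤n⇒m⊔n≡n x≤y ⟨
    x ⊔ y                ∎
    where open ≡-Reasoning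
  ... | inj₂ y≤x = begin
    (x ⇒ y) ⇒ y                ≡⟨ cong (λ d → n ⊓ (d + y)) (¬⇒-below x≤n y≤x) ⟩
    n ⊓ ((x ∸ y) + y)          ≡⟨ cong (n ⊓_) (m∸n+n≡m y≤x) ⟩
    n ⊓ x                      ≡⟨ m≥n⇒m⊓n≡n x≤n ⟩
    x                          ≡⟨ m≥n⇒m⊔n≡m y≤x ⟨
    x ⊔ y                      ∎
    where open ≡-Reasoning

  ∧-is-⊓ : ∀ {x y} → x ≤ n → y ≤ n →
           n ∸ (((n ∸ x) ⇒ (n ∸ y)) ⇒ (n ∸ y)) ≡ x ⊓ y
  ∧-is-⊓ {x} {y} x≤n y≤n = begin
    n ∸ (((n ∸ x) ⇒ (n ∸ y)) ⇒ (n ∸ y))  ≡⟨ cong (n ∸_) (∨-is-⊔ (m∸n≤m n x) (m∸n≤m n y)) ⟩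
    n ∸ ((n ∸ x) ⊔ (n ∸ y))              ≡⟨ ∸-distribˡ-⊔-⊓ n (n ∸ x) (n ∸ y) ⟩
    (n ∸ (n ∸ x)) ⊓ (n ∸ (n ∸ y))        ≡⟨ cong₂ _⊓_ (m∸[m∸n]≡n x≤n) (m∸[m∸n]≡n y≤n) ⟩
    x ⊓ y                                ∎
    where open ≡-Reasoning

  -- Semantic form of the tautology used below.  If x ≤ y the middle
  -- implication is (x ⇒ c) ⇒ (x ⇒ c) = 1; otherwise y ≤ y ∨ c lies below it.
  discharge-≤ : ∀ x {y c} → y ≤ n → c ≤ n → y ≤ ((x ⊓ y) ⇒ c) ⇒ (x ⇒ c)
  discharge-≤ x {y} {c} y≤n c≤n with ≤-total x y
  ... | inj₁ x≤y rewrite m≤n⇒m⊓n≡m x≤y | ⇒-top (≤-refl {x ⇒ c}) = y≤n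
  ... | inj₂ y≤x rewrite m≥n⇒m⊓n≡n y≤x = begin
    y                   ≤⟨ m≤m⊔n y c ⟩
    y ⊔ c               ≡⟨ ∨-is-⊔ y≤n c≤n ⟨
    (y ⇒ c) ⇒ c         ≤⟨ ⇒-monoʳ (y ⇒ c) (≤-⇒ x c≤n) ⟩
    (y ⇒ c) ⇒ (x ⇒ c)   ∎
    where open ≤-Reasoning

pand : PForm → PForm → PForm
pand χ θ = pneg (pimp (pimp (pneg χ) (pneg θ)) (pneg θ))

-- q → ((p ∧ q → r) → (p → r)): a true conjunct may be dropped from an antecedent.
discharge : PForm
discharge = pimp (pvar 1) (pimp (pimp (pand (pvar 0) (pvar 1)) (pvar 2)) (pimp (pvar 0) (pvar 2)))

-- Its value is y ⇒ (((x ∧ y) ⇒ c) ⇒ (x ⇒ c)), which is 1 by discharge-≤.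
discharge-taut : (n : ℕ) → Taut n discharge
discharge-taut n v v≤n =
  ⇒-top (subst (λ m → v 1 ≤ (m ⇒ v 2) ⇒ (v 0 ⇒ v 2))
               (sym (∧-is-⊓ (v≤n 0) (v≤n 1)))
               (discharge-≤ (v 0) (v≤n 1) (v≤n 2)))
  where open Łukasiewicz n

module _ {A : Set} {n : ℕ} where

  discharge-rule : {φ ψ χ : Fm A} → Thm n ψ → Thm n (imp (φ ∧ ψ) χ) → Thm n (imp φ χ)
  discharge-rule {φ} {ψ} {χ} ⊢ψ ⊢φ∧ψ→χ =
    mp ⊢φ∧ψ→χ (mp ⊢ψ (us instantiate (taut discharge (discharge-taut n))))
    where
    instantiate : ℕ → Fm A
    instantiate 0 = φ
    instantiate 1 = ψ
    instantiate _ = χ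

module _ {A : Set} where

  pow-substF : (σ : ℕ → Fm A) (k : ℕ) (ψ : Fm A) → substF σ (pow k ψ) ≡ pow k (substF σ ψ)
  pow-substF σ zero ψ = refl
  pow-substF σ (suc zero) ψ = refl
  pow-substF σ (suc (suc k)) ψ = cong (substF σ ψ ⊙_) (pow-substF σ (suc k) ψ)

  -- Renaming every variable i to i+1 frees the variable 0 …
  shift : ℕ → Fm A
  shift i = var (suc i)

  -- … and plugging φ for 0 while renaming i+1 back to i undoes the shift.
  plug : Fm A → ℕ → Fm A
  plug φ zero = φ
  plug φ (suc i) = var i

  mutual
    plug-shiftF : (φ ψ : Fm A) → substF (plug φ) (substF shift ψ) ≡ ψ
    plug-shiftF φ (var i) = refl
    plug-shiftF φ bot = refl
    plug-shiftF φ (neg ψ) = cong neg (plug-shiftF φ ψ)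
    plug-shiftF φ (imp ψ χ) = cong₂ imp (plug-shiftF φ ψ) (plug-shiftF φ χ)
    plug-shiftF φ (box α ψ) = cong₂ box (plug-shiftP φ α) (plug-shiftF φ ψ)

    plug-shiftP : (φ : Fm A) (α : Prog A) → substP (plug φ) (substP shift α) ≡ α
    plug-shiftP φ (atom a) = refl
    plug-shiftP φ (test ψ) = cong test (plug-shiftF φ ψ)
    plug-shiftP φ (seq α β) = cong₂ seq (plug-shiftP φ α) (plug-shiftP φ β)
    plug-shiftP φ (cho α β) = cong₂ cho (plug-shiftP φ α) (plug-shiftP φ β)
    plug-shiftP φ (star α) = cong star (plug-shiftP φ α)

-- The induction axiom instantiated at an arbitrary formula and program:
-- substitute into the axiom for the renamed-apart program shift(α).
induction : {A : Set} (n : ℕ) (α : Prog A) (φ : Fm A) →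
  Thm n (imp (φ ∧ box (star α) (pow n (imp φ (box α φ)))) (box (star α) φ))
induction {A} n α φ =
  subst (λ β → Thm n (imp (φ ∧ box (star β) (pow n (imp φ (box β φ)))) (box (star β) φ)))
        (plug-shiftP φ α)
        (subst (λ ψ → Thm n (imp (φ ∧ box (star α′) ψ) (box (star α′) φ)))
               (pow-substF (plug φ) n (imp p (box (substP shift α) p)))
               (us (plug φ) (axInd (substP shift α))))
  where
  α′ : Prog A
  α′ = substP (plug φ) (substP shift α)

lemma4p5 : (A : Set) → A → (n : ℕ) → 1 ≤ n →
    (α : Prog A) (φ : Fm A) →
    Thm n (pow n (imp φ (box α φ))) → Thm n (imp φ (box (star α) φ))
lemma4p5 A _ n _ α φ premise =
  discharge-rule (nec (star α) premise) (induction n α φ)
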